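{- Let $T$ be a rooted tree whose root $r$ has degree $1$, and let $u$ be a surficial vertex of $T$. Then for every son $v$ of $u$, $Sub_T(v)$ is a full tree.
   Context: Edges are oriented away from the root; $x^+$ denotes the father of a non-root vertex $x$, and the level of a vertex is its distance from $r$. For a non-root vertex $v$, $Sub_T(v)$ is the subtree induced by $v^+$, $v$ and all descendants of $v$, rooted at $v^+$ (levels measured from $v^+$). $Sub_T(v)$ is a full tree if, for some $m\ge1$, all its vertices other than $v^+$ with no sons lie at level $m$ of $Sub_T(v)$ and every vertex at levels $1,\dots,m-1$ of $Sub_T(v)$ has at least two sons. $Sub_T(v)$ is a maximal full subtree if $Sub_T(v)$ is full, $v^+\ne r$, and $Sub_T(v^+)$ is not full. Let $I=\{x^+ : Sub_T(x)\text{ is a maximal full subtree}\}$; a surficial vertex of $T$ is a vertex of $I$ whose level in $T$ is maximum among all vertices of $I$. -}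

module Defs where

open import Data.Nat using (ℕ; zero; suc; _≤_; _<_)
open import Data.List using (List; []; _∷_; length; _++_)
open import Data.Maybe using (Maybe; just; nothing)
open import Data.Product using (Σ; ∃; _×_; _,_)
open import Relation.Nullary using (¬_)
open import Relation.Binary.PropositionalEquality using (_≡_; _≢_)

data Tree : Set where
  node : List Tree → Tree

sons : Tree → List Tree
sons (node ts) = ts

-- Vertices of a tree are addressed by paths from the root (lists of son
-- indices); the level of a vertex is the length of its path.  The father of
-- the vertex  p ++ (i ∷ [])  is  p ;  the root is  [] .
-- sub t p = the subtree of t hanging at vertex p (if p is a vertex).
mutual
  sub : Tree → List ℕ → Maybe Tree
  sub t [] = just t
  sub (node ts) (i ∷ p) = subL ts i p

  subL : List Tree → ℕ → List ℕ → Maybe Tree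
  subL [] _ _ = nothing
  subL (t ∷ ts) zero p = sub t p
  subL (t ∷ ts) (suc i) p = subL ts i p

-- Sub_T(v) for v = p ++ [i] whose descendant-subtree is s:
-- the tree rooted at v^+ = p having the single son v.
SubTree : Tree → Tree
SubTree s = node (s ∷ [])

Full : Tree → Set
Full R = Σ ℕ λ m → (1 ≤ m)
  × (∀ (p : List ℕ) (s : Tree) → p ≢ [] → sub R p ≡ just s → sons s ≡ [] → length p ≡ m)
  × (∀ (p : List ℕ) (s : Tree) → 1 ≤ length p → length p < m → sub R p ≡ just s → 2 ≤ length (sons s))

-- p ∈ I :  p = x^+ for some x = p ++ [i] with Sub_T(x) a maximal full subtree,
-- i.e. Sub_T(x) full, x^+ = p ≠ r, and Sub_T(x^+) = Sub_T(p) not full.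
InI : Tree → List ℕ → Set
InI T p = Σ ℕ λ i → Σ Tree λ s → Σ Tree λ s' →
    sub T (p ++ (i ∷ [])) ≡ just s
  × Full (SubTree s)
  × p ≢ []
  × sub T p ≡ just s'
  × ¬ Full (SubTree s')

Surficial : Tree → List ℕ → Set
Surficial T u = InI T u × (∀ (w : List ℕ) → InI T w → length w ≤ length u)

{-# OPTIONS --safe #-}
-- If Sub_T(v) is not full for a vertex v ≠ r, follow first sons downwards from v:
-- since a single edge is full, one eventually reaches a vertex x with Sub_T(x)
-- full and Sub_T(x⁺) not full, so x⁺ ∈ I lies at least as deep as v.  A son of
-- a vertex of maximal level in I is therefore the root of a full subtree.
module Submission where

open import Defs
open import Data.Nat using (ℕ; zero; suc; _≤_; _<_; z≤n; s≤s; _≤?_)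
open import Data.Nat.Properties using (≤-refl; ≤-trans; <⇒≤; suc-injective; m<m+n; <⇒≱)
open import Data.List using (List; []; _∷_; [_]; _++_; _∷ʳ_; length)
open import Data.List.Properties using (length-++; ++-conicalʳ)
open import Data.List.Relation.Unary.All using (All; []; _∷_)
open import Data.Maybe using (just)
open import Data.Product using (Σ; ∃-syntax; _×_; _,_; proj₂)
open import Data.Sum using (_⊎_; inj₁; inj₂)
open import Relation.Nullary using (Dec; yes; no; contradiction)
open import Relation.Nullary.Decidable using (map′)
open import Relation.Binary.PropositionalEquality using (_≡_; _≢_; refl; sym; cong; subst)

-- Heights are counted from s itself, so Perfect s h corresponds to Full (SubTree s) with m = suc h.
data Perfect : Tree → ℕ → Set where
  leaf   : Perfect (node []) 0
  branch : ∀ {ts h} → 2 ≤ length ts → All (λ t → Perfect t h) ts → Perfect (node ts) (suc h)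

leftDepth : Tree → ℕ
leftDepth (node [])      = 0
leftDepth (node (t ∷ _)) = suc (leftDepth t)

perfect⇒height≡leftDepth : ∀ {s h} → Perfect s h → h ≡ leftDepth s
perfect⇒height≡leftDepth leaf                     = refl
perfect⇒height≡leftDepth (branch () [])
perfect⇒height≡leftDepth (branch _ (perfect ∷ _)) = cong suc (perfect⇒height≡leftDepth perfect)

mutual
  perfect? : ∀ s h → Dec (Perfect s h)
  perfect? (node []) zero    = yes leaf
  perfect? (node []) (suc h) = no λ { (branch () _) }
  perfect? (node (t ∷ ts)) zero = no λ ()
  perfect? (node (t ∷ ts)) (suc h) with 2 ≤? length (t ∷ ts) | allPerfect? (t ∷ ts) h
  ... | yes branching | yes perfect = yes (branch branching perfect)
  ... | no ¬branching | _           = no λ { (branch branching _) → ¬branching branching }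
  ... | _             | no ¬perfect = no λ { (branch _ perfect) → ¬perfect perfect }

  allPerfect? : ∀ ts h → Dec (All (λ t → Perfect t h) ts)
  allPerfect? [] h = yes []
  allPerfect? (t ∷ ts) h with perfect? t h | allPerfect? ts h
  ... | yes p  | yes ps = yes (p ∷ ps)
  ... | no ¬p  | _      = no λ { (p ∷ _) → ¬p p }
  ... | _      | no ¬ps = no λ { (_ ∷ ps) → ¬ps ps }

subL-All : ∀ {P : Tree → Set} {ts i p x} → All P ts → subL ts i p ≡ just x →
           Σ Tree λ t → P t × sub t p ≡ just x
subL-All {i = zero}  (pt ∷ _)  eq = _ , pt , eq
subL-All {i = suc i} (_ ∷ pts) eq = subL-All pts eq

mutual
  sub-++ : ∀ t q r {x} → sub t q ≡ just x → sub t (q ++ r) ≡ sub x r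
  sub-++ t         []      r refl = refl
  sub-++ (node ts) (i ∷ q) r eq   = subL-++ ts i q r eq

  subL-++ : ∀ ts i q r {x} → subL ts i q ≡ just x → subL ts i (q ++ r) ≡ sub x r
  subL-++ (t ∷ ts) zero    q r eq = sub-++ t q r eq
  subL-++ (t ∷ ts) (suc i) q r eq = subL-++ ts i q r eq

LeavesAt : Tree → ℕ → Set
LeavesAt s h = ∀ p x → sub s p ≡ just x → sons x ≡ [] → length p ≡ h

BranchingBelow : Tree → ℕ → Set
BranchingBelow s h = ∀ p x → length p < h → sub s p ≡ just x → 2 ≤ length (sons x)

perfect⇒leavesAt : ∀ {s h} → Perfect s h → LeavesAt s h
perfect⇒leavesAt leaf              []      _ refl _      = refl
perfect⇒leavesAt (branch () _)     []      _ refl refl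
perfect⇒leavesAt (branch _ perfect) (i ∷ p) x eq   isLeaf with subL-All perfect eq
... | _ , perfectₜ , eqₜ = cong suc (perfect⇒leavesAt perfectₜ p x eqₜ isLeaf)

perfect⇒branchingBelow : ∀ {s h} → Perfect s h → BranchingBelow s h
perfect⇒branchingBelow (branch branching _) []      _ _         refl = branching
perfect⇒branchingBelow (branch _ perfect)   (i ∷ p) x (s≤s p<h) eq  with subL-All perfect eq
... | _ , perfectₜ , eqₜ = perfect⇒branchingBelow perfectₜ p x p<h eqₜ

∃-leaf : ∀ s → Σ (List ℕ) λ p → Σ Tree λ x → sub s p ≡ just x × sons x ≡ []
∃-leaf (node [])      = [] , node [] , refl , refl
∃-leaf (node (t ∷ _)) with ∃-leaf t
... | p , x , eq , isLeaf = zero ∷ p , x , eq , isLeaf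

mutual
  leavesAt∧branchingBelow⇒perfect : ∀ s h → LeavesAt s h → BranchingBelow s h → Perfect s h
  leavesAt∧branchingBelow⇒perfect (node []) h leavesAt _ with leavesAt [] _ refl refl
  ... | refl = leaf
  leavesAt∧branchingBelow⇒perfect (node (t ∷ ts)) zero leavesAt _ with ∃-leaf t
  ... | p , x , eq , isLeaf with () ← leavesAt (zero ∷ p) x eq isLeaf
  leavesAt∧branchingBelow⇒perfect (node (t ∷ ts)) (suc h) leavesAt branchingBelow =
    branch (branchingBelow [] _ (s≤s z≤n) refl)
           (allPerfect (t ∷ ts) h (λ i p x eq isLeaf → suc-injective (leavesAt (i ∷ p) x eq isLeaf))
                                  (λ i p x p<h eq → branchingBelow (i ∷ p) x (s≤s p<h) eq))

  allPerfect : ∀ ts h →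
               (∀ i p x → subL ts i p ≡ just x → sons x ≡ [] → length p ≡ h) →
               (∀ i p x → length p < h → subL ts i p ≡ just x → 2 ≤ length (sons x)) →
               All (λ t → Perfect t h) ts
  allPerfect []       h _        _              = []
  allPerfect (t ∷ ts) h leavesAt branchingBelow =
    leavesAt∧branchingBelow⇒perfect t h (leavesAt zero) (branchingBelow zero)
    ∷ allPerfect ts h (λ i → leavesAt (suc i)) (λ i → branchingBelow (suc i))

perfect⇒full : ∀ {s h} → Perfect s h → Full (SubTree s)
perfect⇒full {s} {h} perfect = suc h , s≤s z≤n , leavesAt , branchingBelow
  where
  leavesAt : ∀ p x → p ≢ [] → sub (SubTree s) p ≡ just x → sons x ≡ [] → length p ≡ suc h
  leavesAt []           _ p≢[] _  _      = contradiction refl p≢[]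
  leavesAt (zero ∷ p)   x _    eq isLeaf = cong suc (perfect⇒leavesAt perfect p x eq isLeaf)
  leavesAt (suc _ ∷ _)  _ _    ()

  branchingBelow : ∀ p x → 1 ≤ length p → length p < suc h → sub (SubTree s) p ≡ just x →
                   2 ≤ length (sons x)
  branchingBelow (zero ∷ p)  x _ (s≤s p<h) eq = perfect⇒branchingBelow perfect p x p<h eq
  branchingBelow (suc _ ∷ _) _ _ _         ()

full⇒perfect : ∀ {s} → Full (SubTree s) → Perfect s (leftDepth s)
full⇒perfect {s} (suc h , _ , leavesAt , branchingBelow) =
  subst (Perfect s) (perfect⇒height≡leftDepth perfect) perfect
  where
  perfect : Perfect s h
  perfect = leavesAt∧branchingBelow⇒perfect s h
    (λ p x eq isLeaf → suc-injective (leavesAt (zero ∷ p) x (λ ()) eq isLeaf))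
    (λ p x p<h eq → branchingBelow (zero ∷ p) x (s≤s z≤n) (s≤s p<h) eq)

full? : ∀ s → Dec (Full (SubTree s))
full? s = map′ perfect⇒full full⇒perfect (perfect? s (leftDepth s))

length<length-∷ʳ : ∀ (q : List ℕ) i → length q < length (q ∷ʳ i)
length<length-∷ʳ q i = subst (length q <_) (sym (length-++ q)) (m<m+n (length q) (s≤s z≤n))

∷ʳ≢[] : ∀ (q : List ℕ) i → q ∷ʳ i ≢ []
∷ʳ≢[] q i eq with () ← ++-conicalʳ q [ i ] eq

full⊎deeper∈I : ∀ T q {s} → sub T q ≡ just s → q ≢ [] →
                Full (SubTree s) ⊎ ∃[ w ] InI T w × length q ≤ length w
full⊎deeper∈I T q {s} eq q≢[] with full? s
... | yes full = inj₁ full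
full⊎deeper∈I T q {node []} eq q≢[] | no ¬full = contradiction (perfect⇒full leaf) ¬full
full⊎deeper∈I T q {node (t ∷ ts)} eq q≢[] | no ¬full
  with full⊎deeper∈I T (q ∷ʳ zero) (sub-++ T q [ zero ] eq) (∷ʳ≢[] q zero)
... | inj₁ fullₜ = inj₂ (q , q∈I , ≤-refl)
  where
  q∈I : InI T q
  q∈I = zero , t , node (t ∷ ts) , sub-++ T q [ zero ] eq , fullₜ , q≢[] , eq , ¬full
... | inj₂ (w , w∈I , q0≤w) = inj₂ (w , w∈I , ≤-trans (<⇒≤ (length<length-∷ʳ q zero)) q0≤w)

sons-full-below-deepest-I : ∀ T u → (∀ w → InI T w → length w ≤ length u) →
                            ∀ i s → sub T (u ∷ʳ i) ≡ just s → Full (SubTree s)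
sons-full-below-deepest-I T u deepest i s eq with full⊎deeper∈I T (u ∷ʳ i) eq (∷ʳ≢[] u i)
... | inj₁ full               = full
... | inj₂ (w , w∈I , ui≤w) =
  contradiction (deepest w w∈I) (<⇒≱ (≤-trans (length<length-∷ʳ u i) ui≤w))

proposition1 : (t : Tree) (u : List ℕ) → Surficial (node (t ∷ [])) u →
    (i : ℕ) (s : Tree) → sub (node (t ∷ [])) (u ++ (i ∷ [])) ≡ just s → Full (SubTree s)
proposition1 t u surficial = sons-full-below-deepest-I (node (t ∷ [])) u (proj₂ surficial)
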